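{- Let $H$ be a stacked triangulation and let $f=(x,y,z)$ be a face of $H$. Then two new vertices can be added inside $f$ (with new edges drawn inside $f$) so that the resulting plane graph $G$ is a stacked triangulation with the following property: for every edge guard set $\Gamma$ of $G$ there is an edge guard set $\Gamma'$ of $G$ with $|\Gamma'| = |\Gamma|$ and $\{x,y\} \subseteq V(\Gamma')$.
   Context: A plane graph is a simple graph together with a crossing-free embedding in $\mathbb{R}^2$. Stacked triangulations are defined recursively: (i) a triangle (a plane $3$-cycle) is a stacked triangulation; (ii) if $G$ is a stacked triangulation and $f=(x,y,z)$ is an inner face, then the plane graph obtained by placing a new vertex $v$ inside $f$ and joining it to $x,y,z$ is a stacked triangulation; any plane embedding of such a graph is also regarded as a stacked triangulation. For a plane graph $G=(V,E)$, a face $f$ is guarded by an edge $vw \in E$ if at least one of $v,w$ lies on the boundary of $f$. A set $\Gamma \subseteq E$ is an edge guard set if every face of $G$ (including the outer face) is guarded by some edge of $\Gamma$. For $\Gamma \subseteq E$, $V(\Gamma)$ denotes the set of endpoints of edges in $\Gamma$. -}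

module Defs where

open import Data.Nat using (ℕ; zero; suc; _<_)
open import Data.Fin using (Fin; zero; suc; toℕ; inject₁; fromℕ)
open import Data.Fin.Permutation using (Permutation′; _⟨$⟩ʳ_)
open import Data.Product using (Σ; ∃; _×_; _,_)
open import Data.Sum using (_⊎_)
open import Data.List using (List; []; _∷_; _++_; map)
open import Data.List.Membership.Propositional using (_∈_)
open import Data.List.Relation.Unary.All using (All)
open import Data.List.Relation.Unary.Any using (Any)
open import Data.List.Relation.Unary.Unique.Propositional using (Unique)
open import Data.List.Relation.Binary.Pointwise using (Pointwise)
open import Data.List.Relation.Binary.Permutation.Propositional using (_↭_)
open import Relation.Binary.PropositionalEquality using (_≡_; _≢_)
open import Relation.Nullary using (¬_)

Tri : ℕ → Set
Tri n = Fin n × Fin n × Fin n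

_∈T_ : ∀ {n} → Fin n → Tri n → Set
v ∈T (a , b , c) = v ≡ a ⊎ v ≡ b ⊎ v ≡ c

_≅T_ : ∀ {n} → Tri n → Tri n → Set
s ≅T t = ∀ v → (v ∈T s → v ∈T t) × (v ∈T t → v ∈T s)

mapT : ∀ {m n} → (Fin m → Fin n) → Tri m → Tri n
mapT g (a , b , c) = g a , g b , g c

injT : ∀ {n} → Tri n → Tri (suc n)
injT = mapT inject₁

-- A plane triangulation is represented by its vertex set Fin n, its
-- outer face and the list of its inner faces (every face is a triangle;
-- the graph and its embedding are determined by the facial triangles).
data Stacked : (n : ℕ) → Tri n → List (Tri n) → Set where
  base    : Stacked 3 (zero , suc zero , suc (suc zero))
                      ((zero , suc zero , suc (suc zero)) ∷ [])
  stack   : ∀ {n o I R x y z} → Stacked n o I → I ↭ ((x , y , z) ∷ R) →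
            Stacked (suc n) (injT o)
              (map injT R ++ ((inject₁ x , inject₁ y , fromℕ n)
                            ∷ (inject₁ y , inject₁ z , fromℕ n)
                            ∷ (inject₁ z , inject₁ x , fromℕ n) ∷ []))
  -- any plane embedding of such a graph: by Whitney's theorem the facial
  -- triangles are fixed, only the choice of the outer face changes
  reembed : ∀ {n o I t R} → Stacked n o I → I ↭ (t ∷ R) → Stacked n t (o ∷ R)
  relabel : ∀ {n o I} (π : Permutation′ n) → Stacked n o I →
            Stacked n (mapT (π ⟨$⟩ʳ_) o) (map (mapT (π ⟨$⟩ʳ_)) I)
  -- the representation does not depend on the order of the face list
  -- or on how the corners of a face are listed
  reorder : ∀ {n o I o′ I′} → Stacked n o I → o ≅T o′ →
            Pointwise _≅T_ I I′ → Stacked n o′ I′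

faces : ∀ {n} → Tri n → List (Tri n) → List (Tri n)
faces o I = o ∷ I

Adj : ∀ {n} → Tri n → List (Tri n) → Fin n → Fin n → Set
Adj o I v w = v ≢ w × Any (λ t → v ∈T t × w ∈T t) (faces o I)

Guards : ∀ {n} → Fin n × Fin n → Tri n → Set
Guards (v , w) t = v ∈T t ⊎ w ∈T t

-- An edge set is a duplicate-free list of edges, each written (v , w) with v < w,
-- so that its cardinality is its length.
IsEdgeSet : ∀ {n} → Tri n → List (Tri n) → List (Fin n × Fin n) → Set
IsEdgeSet o I Γ =
  All (λ e → toℕ (Data.Product.proj₁ e) < toℕ (Data.Product.proj₂ e)
           × Adj o I (Data.Product.proj₁ e) (Data.Product.proj₂ e)) Γ
  × Unique Γ

EdgeGuardSet : ∀ {n} → Tri n → List (Tri n) → List (Fin n × Fin n) → Set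
EdgeGuardSet o I Γ =
  IsEdgeSet o I Γ × All (λ t → Any (λ e → Guards e t) Γ) (faces o I)

_∈V_ : ∀ {n} → Fin n → List (Fin n × Fin n) → Set
v ∈V Γ = Any (λ e → v ≡ Data.Product.proj₁ e ⊎ v ≡ Data.Product.proj₂ e) Γ

-- old vertices of H inside G (which has two more vertices) and the two new ones
inj₂ : ∀ {n} → Fin n → Fin (suc (suc n))
inj₂ v = inject₁ (inject₁ v)

new₁ new₂ : ∀ {n} → Fin (suc (suc n))
new₁ {n} = inject₁ (fromℕ n)
new₂ {n} = fromℕ (suc n)

module Submission where

-- Re-embed H so that f is an inner face, stack a vertex V₁
-- into (x,y,z) and then a vertex V₂ into the new face (x,y,V₁).  The new
-- faces are (y,z,V₁), (z,x,V₁), (x,y,V₂), (y,V₁,V₂) and (V₁,x,V₂).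
--
-- Every face through V₁ or V₂ contains x or y, V₁ only
-- sees x, y, z, V₂ and V₂ only sees x, y, V₁.  Let Γ be an edge guard set.
-- If Γ covers neither x nor y, the edge guarding (x,y,V₂) is incident to V₂
-- and may be replaced by xy.  If Γ covers x but not y, the edge e guarding
-- (y,V₁,V₂) is incident to V₁ or V₂; replace it by yz when e contains z (then
-- e avoids x, so x stays covered) and by xy otherwise.  The case "y covered,
-- x not" is the mirror image, using (V₁,x,V₂) and xz.  Each replacement keeps
-- every face guarded, and keeps the size because the new edge contains a
-- vertex not covered by Γ (so it is not already in Γ).

open import Defs
open import Data.Empty using (⊥-elim)
open import Data.Nat using (ℕ; suc; _<_)
open import Data.Nat.Properties using (<-cmp)
open import Data.Fin using (Fin; toℕ; inject₁; fromℕ; _≟_)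
open import Data.Fin.Properties using (inject₁-injective; fromℕ≢inject₁; toℕ-injective)
open import Data.Fin.Permutation using (Permutation′; _⟨$⟩ʳ_; _⟨$⟩ˡ_; inverseˡ)
open import Data.Product using (Σ; _×_; _,_; proj₁; proj₂)
open import Data.Sum using (_⊎_; swap; map₂; [_,_]′) renaming (inj₁ to ι₁; inj₂ to ι₂)
open import Data.List using (List; []; _∷_; _++_; map; length)
open import Data.List.Properties using (map-++; map-∘; ++-assoc)
open import Data.List.Relation.Unary.All as All using (All; []; _∷_)
import Data.List.Relation.Unary.All.Properties as AllP
open import Data.List.Relation.Unary.Any as Any using (Any; here; there)
import Data.List.Relation.Unary.Any.Properties as AnyP
open import Data.List.Relation.Unary.AllPairs using (_∷_)
open import Data.List.Relation.Unary.Unique.Propositional using (Unique)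
open import Data.List.Membership.Propositional using (_∈_; find)
open import Data.List.Membership.Propositional.Properties using (∈-∃++)
open import Data.List.Relation.Binary.Pointwise using (Pointwise; []; _∷_)
import Data.List.Relation.Binary.Pointwise.Properties as Pointwise
open import Data.List.Relation.Binary.Permutation.Propositional
  using (_↭_; ↭-refl; ↭-sym; ↭-trans; ↭-prep; ↭-swap; ↭-reflexive; ↭⇒↭ₛ)
import Data.List.Relation.Binary.Permutation.Propositional.Properties as Perm
import Data.List.Relation.Binary.Permutation.Setoid.Properties as PermSetoid
open import Function using (_∘_)
open import Relation.Binary.Definitions using (tri<; tri≈; tri>)
open import Relation.Binary.PropositionalEquality
open import Relation.Nullary using (¬_; Dec; yes; no)
open import Relation.Nullary.Decidable using (_⊎-dec_)

unique-↭ : ∀ {A : Set} {xs ys : List A} → xs ↭ ys → Unique xs → Unique ys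
unique-↭ {A} p = PermSetoid.Unique-resp-↭ (setoid A) (↭⇒↭ₛ p)

extract : ∀ {A : Set} {x : A} {xs} → x ∈ xs → Σ (List A) λ ys → xs ↭ x ∷ ys
extract {x = x} x∈xs with ∈-∃++ x∈xs
... | ys , zs , refl = ys ++ zs , Perm.shift x ys zs

pattern corner₁ p = ι₁ p
pattern corner₂ p = ι₂ (ι₁ p)
pattern corner₃ p = ι₂ (ι₂ p)

corners : ∀ {n} {P : Fin n → Set} {a b c : Fin n} →
          P a → P b → P c → ∀ v → v ∈T (a , b , c) → P v
corners pa pb pc v (corner₁ refl) = pa
corners pa pb pc v (corner₂ refl) = pb
corners pa pb pc v (corner₃ refl) = pc

not-corner : ∀ {n} {v a b c : Fin n} → v ≢ a → v ≢ b → v ≢ c → ¬ (v ∈T (a , b , c))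
not-corner v≢a v≢b v≢c (corner₁ v≡a) = v≢a v≡a
not-corner v≢a v≢b v≢c (corner₂ v≡b) = v≢b v≡b
not-corner v≢a v≢b v≢c (corner₃ v≡c) = v≢c v≡c

Distinct : ∀ {n} → Tri n → Set
Distinct (a , b , c) = a ≢ b × b ≢ c × a ≢ c

pigeonhole : ∀ {n} {p q r u w : Fin n} →
             p ≡ u ⊎ p ≡ w → q ≡ u ⊎ q ≡ w → r ≡ u ⊎ r ≡ w → ¬ Distinct (p , q , r)
pigeonhole (ι₁ p≡u) (ι₁ q≡u) _        (p≢q , _ , _) = p≢q (trans p≡u (sym q≡u))
pigeonhole (ι₂ p≡w) (ι₂ q≡w) _        (p≢q , _ , _) = p≢q (trans p≡w (sym q≡w))
pigeonhole (ι₁ p≡u) (ι₂ _)   (ι₁ r≡u) (_ , _ , p≢r) = p≢r (trans p≡u (sym r≡u))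
pigeonhole (ι₁ _)   (ι₂ q≡w) (ι₂ r≡w) (_ , q≢r , _) = q≢r (trans q≡w (sym r≡w))
pigeonhole (ι₂ _)   (ι₁ q≡u) (ι₁ r≡u) (_ , q≢r , _) = q≢r (trans q≡u (sym r≡u))
pigeonhole (ι₂ p≡w) (ι₁ _)   (ι₂ r≡w) (_ , _ , p≢r) = p≢r (trans p≡w (sym r≡w))

collapsed : ∀ {n} {s t : Tri n} (u w : Fin n) → s ≅T t →
            (∀ v → v ∈T t → v ≡ u ⊎ v ≡ w) → ¬ Distinct s
collapsed {s = p , q , r} u w s≅t t⊆uw =
  pigeonhole (in-uw p (corner₁ refl)) (in-uw q (corner₂ refl)) (in-uw r (corner₃ refl))
  where
  in-uw : ∀ v → v ∈T (p , q , r) → v ≡ u ⊎ v ≡ w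
  in-uw v v∈s = t⊆uw v (proj₁ (s≅t v) v∈s)

distinct-≅ : ∀ {n} {s t : Tri n} → s ≅T t → Distinct s → Distinct t
distinct-≅ {t = a , b , c} s≅t ds =
    (λ a≡b → collapsed a c s≅t (corners (ι₁ refl) (ι₁ (sym a≡b)) (ι₂ refl)) ds)
  , (λ b≡c → collapsed a b s≅t (corners (ι₁ refl) (ι₂ refl) (ι₂ (sym b≡c))) ds)
  , (λ a≡c → collapsed a b s≅t (corners (ι₁ refl) (ι₂ refl) (ι₁ (sym a≡c))) ds)

distinct-pointwise : ∀ {n} {I I′ : List (Tri n)} →
                     Pointwise _≅T_ I I′ → All Distinct I → All Distinct I′
distinct-pointwise []          []        = []
distinct-pointwise (s≅t ∷ I≅I′) (d ∷ ds) = distinct-≅ s≅t d ∷ distinct-pointwise I≅I′ ds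

distinct-map : ∀ {m n} (g : Fin m → Fin n) → (∀ {a b} → g a ≡ g b → a ≡ b) →
               ∀ {t} → Distinct t → Distinct (mapT g t)
distinct-map g g-inj (a≢b , b≢c , a≢c) =
  a≢b ∘ g-inj , b≢c ∘ g-inj , a≢c ∘ g-inj

permute-injective : ∀ {n} (π : Permutation′ n) {a b} → π ⟨$⟩ʳ a ≡ π ⟨$⟩ʳ b → a ≡ b
permute-injective π {a} {b} πa≡πb = begin
  a                    ≡⟨ sym (inverseˡ π) ⟩
  π ⟨$⟩ˡ (π ⟨$⟩ʳ a)  ≡⟨ cong (π ⟨$⟩ˡ_) πa≡πb ⟩
  π ⟨$⟩ˡ (π ⟨$⟩ʳ b)  ≡⟨ inverseˡ π ⟩
  b                    ∎
  where open ≡-Reasoning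

fresh≢old : ∀ {n} {a : Fin n} → inject₁ a ≢ fromℕ n
fresh≢old a≡new = fromℕ≢inject₁ (sym a≡new)

-- Every face of a stacked triangulation has three distinct corners; this is
-- what makes x, y, z (and hence X, Y, Z of the gadget) pairwise distinct.
stacked-distinct : ∀ {n o I} → Stacked n o I → All Distinct (faces o I)
stacked-distinct base =
  ((λ ()) , (λ ()) , (λ ())) ∷ ((λ ()) , (λ ()) , (λ ())) ∷ []
stacked-distinct (stack S p) with stacked-distinct S
... | d ∷ dI with Perm.All-resp-↭ p dI
... | (x≢y , y≢z , x≢z) ∷ dR =
  old d ∷ AllP.++⁺ (AllP.map⁺ (All.map old dR))
    ((old≢ x≢y , fresh≢old , fresh≢old) ∷
     (old≢ y≢z , fresh≢old , fresh≢old) ∷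
     (old≢ (x≢z ∘ sym) , fresh≢old , fresh≢old) ∷ [])
  where
  old = distinct-map inject₁ inject₁-injective
  old≢ : ∀ {m} {a b : Fin m} → a ≢ b → inject₁ a ≢ inject₁ b
  old≢ a≢b = a≢b ∘ inject₁-injective
stacked-distinct (reembed S p) with stacked-distinct S
... | d ∷ dI with Perm.All-resp-↭ p dI
... | dt ∷ dR = dt ∷ d ∷ dR
stacked-distinct (relabel π S) with stacked-distinct S
... | d ∷ dI = relabelled d ∷ AllP.map⁺ (All.map relabelled dI)
  where relabelled = distinct-map (π ⟨$⟩ʳ_) (permute-injective π)
stacked-distinct (reorder S o≅o′ I≅I′) with stacked-distinct S
... | d ∷ dI = distinct-≅ o≅o′ d ∷ distinct-pointwise I≅I′ dI

inner-face : ∀ {n o I} → Stacked n o I → Σ (Tri n) λ t → Σ (List (Tri n)) λ J → I ≡ t ∷ J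
inner-face base = _ , _ , refl
inner-face (stack {R = R} S p) = nonempty (map injT R)
  where
  nonempty : ∀ {A : Set} (xs : List A) {y : A} {ys} → Σ A λ t → Σ (List A) λ J → xs ++ y ∷ ys ≡ t ∷ J
  nonempty []       = _ , _ , refl
  nonempty (x ∷ xs) = _ , _ , refl
inner-face (reembed S p) = _ , _ , refl
inner-face (relabel π S) with inner-face S
... | t , J , refl = _ , _ , refl
inner-face (reorder S o≅o′ I≅I′) with inner-face S
... | t , J , refl with I≅I′
... | _ ∷ _ = _ , _ , refl

-- Any face f, inner or outer, can be made the first inner face by re-embedding:
-- if f is the outer face, some inner face becomes outer; otherwise f is first
-- made outer and then the old outer face is restored.
reroot : ∀ {n o I f R} → Stacked n o I → faces o I ↭ f ∷ R →
         Σ (Tri n) λ g → Σ (List (Tri n)) λ R₁ → Stacked n g (f ∷ R₁) × g ∷ R₁ ↭ R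
reroot S p with Perm.∈-resp-↭ (↭-sym p) (here refl)
... | here refl with inner-face S
...   | t , J , refl = t , J , reembed S ↭-refl , Perm.drop-∷ p
reroot {o = o} {f = f} S p | there f∈I with extract f∈I
... | J , I↭fJ = o , J , reembed (reembed S I↭fJ) ↭-refl ,
        Perm.drop-∷ (↭-trans (↭-swap f o ↭-refl) (↭-trans (↭-prep o (↭-sym I↭fJ)) p))

module _ {n : ℕ} where

  Incident : Fin n × Fin n → Fin n → Set
  Incident e v = v ≡ proj₁ e ⊎ v ≡ proj₂ e

  incident-guards : ∀ {e v t} → Incident e v → v ∈T t → Guards e t
  incident-guards (ι₁ refl) v∈t = ι₁ v∈t
  incident-guards (ι₂ refl) v∈t = ι₂ v∈t

  guards-incident : ∀ {e t} → Guards e t → Σ (Fin n) λ v → Incident e v × v ∈T t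
  guards-incident (ι₁ v∈t) = _ , ι₁ refl , v∈t
  guards-incident (ι₂ v∈t) = _ , ι₂ refl , v∈t

  incident-∈V : ∀ {Γ e v} → e ∈ Γ → Incident e v → v ∈V Γ
  incident-∈V e∈Γ e∋v = Any.map (λ { refl → e∋v }) e∈Γ

  covered? : ∀ (v : Fin n) Γ → Dec (v ∈V Γ)
  covered? v = Any.any? (λ e → (v ≟ proj₁ e) ⊎-dec (v ≟ proj₂ e))

module EdgeGuards {n : ℕ} (o : Tri n) (I : List (Tri n)) where

  IsEdge : Fin n × Fin n → Set
  IsEdge e = toℕ (proj₁ e) < toℕ (proj₂ e) × Adj o I (proj₁ e) (proj₂ e)

  member-edge : ∀ {Γ e} → EdgeGuardSet o I Γ → e ∈ Γ → IsEdge e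
  member-edge ((edges , _) , _) = All.lookup edges

  edge : ∀ u w → u ≢ w → Any (λ t → u ∈T t × w ∈T t) (faces o I) →
         Σ (Fin n × Fin n) λ e → IsEdge e × Incident e u × Incident e w
  edge u w u≢w uw-face with <-cmp (toℕ u) (toℕ w)
  ... | tri< u<w _ _ = (u , w) , (u<w , u≢w , uw-face) , ι₁ refl , ι₂ refl
  ... | tri≈ _ u≡w _ = ⊥-elim (u≢w (toℕ-injective u≡w))
  ... | tri> _ _ w<u =
    (w , u) , (w<u , u≢w ∘ sym , Any.map (λ { (u∈t , w∈t) → w∈t , u∈t }) uw-face) , ι₂ refl , ι₁ refl

  edge-face : ∀ {e} → IsEdge e → Σ (Tri n) λ t → t ∈ faces o I × (∀ {v} → Incident e v → v ∈T t)
  edge-face (_ , _ , common) with find common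
  ... | t , t∈ , (p∈t , q∈t) = t , t∈ , λ { (ι₁ refl) → p∈t ; (ι₂ refl) → q∈t }

  exchange : ∀ {Γ e L} → Γ ↭ e ∷ L → EdgeGuardSet o I Γ →
             ∀ {u w} → u ≢ w → Any (λ t → u ∈T t × w ∈T t) (faces o I) → ¬ (w ∈V Γ) →
             (∀ {t} → t ∈ faces o I → Guards e t → u ∈T t ⊎ w ∈T t ⊎ Any (λ d → Guards d t) L) →
             Σ (List (Fin n × Fin n)) λ Γ′ →
               EdgeGuardSet o I Γ′ × length Γ′ ≡ length Γ × u ∈V Γ′ × w ∈V Γ′ ×
               (∀ {v} → v ∈V L → v ∈V Γ′)
  exchange {Γ} {e} {L} Γ↭ ((edges , unique) , guarded) {u} {w} u≢w uw-face w∉Γ covers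
    with edge u w u≢w uw-face
  ... | e′ , e′-edge , e′∋u , e′∋w =
    e′ ∷ L ,
    ((e′-edge ∷ All.tail (Perm.All-resp-↭ Γ↭ edges) , All.tabulate e′∉L ∷ unique-L) ,
     All.tabulate guarded′) ,
    sym (Perm.↭-length Γ↭) , here e′∋u , here e′∋w , there
    where
    unique-L : Unique L
    unique-L with unique-↭ Γ↭ unique
    ... | _ ∷ unique-rest = unique-rest
    -- e′ is new: it contains w, which no edge of Γ does
    e′∉L : ∀ {d} → d ∈ L → e′ ≢ d
    e′∉L d∈L refl = w∉Γ (Perm.Any-resp-↭ (↭-sym Γ↭) (there (incident-∈V d∈L e′∋w)))
    guarded′ : ∀ {t} → t ∈ faces o I → Any (λ d → Guards d t) (e′ ∷ L)
    guarded′ t∈ with Perm.Any-resp-↭ Γ↭ (All.lookup guarded t∈)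
    ... | there by-L = there by-L
    ... | here by-e with covers t∈ by-e
    ...   | ι₁ u∈t         = here (incident-guards e′∋u u∈t)
    ...   | ι₂ (ι₁ w∈t)    = here (incident-guards e′∋w w∈t)
    ...   | ι₂ (ι₂ by-L)   = there by-L

module LocalExchange {n : ℕ} (o : Tri n) (I : List (Tri n)) (X Y Z V₁ V₂ : Fin n)
  (X≢Y : X ≢ Y) (X≢Z : X ≢ Z) (Y≢Z : Y ≢ Z)
  (X≢V₁ : X ≢ V₁) (X≢V₂ : X ≢ V₂) (Z≢V₁ : Z ≢ V₁) (Z≢V₂ : Z ≢ V₂)
  (around₁ : All (λ t → V₁ ∈T t → (X ∈T t ⊎ Y ∈T t) ×
                   (∀ a → a ∈T t → a ≡ X ⊎ a ≡ Y ⊎ a ≡ Z ⊎ a ≡ V₁ ⊎ a ≡ V₂)) (faces o I))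
  (around₂ : All (λ t → V₂ ∈T t → (X ∈T t ⊎ Y ∈T t) ×
                   (∀ a → a ∈T t → a ≡ X ⊎ a ≡ Y ⊎ a ≡ V₁ ⊎ a ≡ V₂)) (faces o I))
  (D : Tri n) (D∈ : D ∈ faces o I) (D⊆ : ∀ v → v ∈T D → v ≡ X ⊎ v ≡ Y ⊎ v ≡ V₂)
  (E : Tri n) (E∈ : E ∈ faces o I) (E⊆ : ∀ v → v ∈T E → v ≡ Y ⊎ v ≡ V₁ ⊎ v ≡ V₂)
  (XY-face : Any (λ t → X ∈T t × Y ∈T t) (faces o I))
  (ZY-face : Any (λ t → Z ∈T t × Y ∈T t) (faces o I))
  where

  open EdgeGuards o I

  Five : Fin n → Set
  Five a = a ≡ X ⊎ a ≡ Y ⊎ a ≡ Z ⊎ a ≡ V₁ ⊎ a ≡ V₂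

  neighbour : ∀ {e} → IsEdge e → Incident e V₁ ⊎ Incident e V₂ → ∀ {v} → Incident e v → Five v
  neighbour e-edge e∋V {v} e∋v with edge-face e-edge
  ... | t , t∈ , on-t with e∋V
  ...   | ι₁ e∋V₁ = proj₂ (All.lookup around₁ t∈ (on-t e∋V₁)) v (on-t e∋v)
  ...   | ι₂ e∋V₂ with proj₂ (All.lookup around₂ t∈ (on-t e∋V₂)) v (on-t e∋v)
  ...     | ι₁ v≡X                = ι₁ v≡X
  ...     | ι₂ (ι₁ v≡Y)           = ι₂ (ι₁ v≡Y)
  ...     | ι₂ (ι₂ v∈V₁V₂)        = ι₂ (ι₂ (ι₂ v∈V₁V₂))

  V₂≁Z : ∀ {e} → IsEdge e → Incident e V₂ → ¬ Incident e Z
  V₂≁Z e-edge e∋V₂ e∋Z with edge-face e-edge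
  ... | t , t∈ , on-t with proj₂ (All.lookup around₂ t∈ (on-t e∋V₂)) Z (on-t e∋Z)
  ...   | ι₁ Z≡X              = X≢Z (sym Z≡X)
  ...   | ι₂ (ι₁ Z≡Y)         = Y≢Z (sym Z≡Y)
  ...   | ι₂ (ι₂ (ι₁ Z≡V₁))   = Z≢V₁ Z≡V₁
  ...   | ι₂ (ι₂ (ι₂ Z≡V₂))   = Z≢V₂ Z≡V₂

  towards-XY : ∀ {t v} → t ∈ faces o I → v ∈T t → Five v → X ∈T t ⊎ Y ∈T t ⊎ v ≡ Z
  towards-XY t∈ v∈t (ι₁ refl)                = ι₁ v∈t
  towards-XY t∈ v∈t (ι₂ (ι₁ refl))           = ι₂ (ι₁ v∈t)
  towards-XY t∈ v∈t (ι₂ (ι₂ (ι₁ v≡Z)))       = ι₂ (ι₂ v≡Z)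
  towards-XY t∈ v∈t (ι₂ (ι₂ (ι₂ (ι₁ refl)))) = map₂ ι₁ (proj₁ (All.lookup around₁ t∈ v∈t))
  towards-XY t∈ v∈t (ι₂ (ι₂ (ι₂ (ι₂ refl)))) = map₂ ι₁ (proj₁ (All.lookup around₂ t∈ v∈t))

  -- Every face guarded by an edge through V₁ or V₂ but not through Z
  -- contains X or Y, so the edge XY guards it as well.
  via-XY : ∀ {e t} → IsEdge e → Incident e V₁ ⊎ Incident e V₂ → ¬ Incident e Z →
           t ∈ faces o I → Guards e t → X ∈T t ⊎ Y ∈T t
  via-XY e-edge e∋V e∌Z t∈ e-guards with guards-incident e-guards
  ... | v , e∋v , v∈t with towards-XY t∈ v∈t (neighbour e-edge e∋V e∋v)
  ...   | ι₁ X∈t          = ι₁ X∈t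
  ...   | ι₂ (ι₁ Y∈t)     = ι₂ Y∈t
  ...   | ι₂ (ι₂ refl)    = ⊥-elim (e∌Z e∋v)

  Normalised : List (Fin n × Fin n) → Set
  Normalised Γ = Σ (List (Fin n × Fin n)) λ Γ′ →
                 EdgeGuardSet o I Γ′ × length Γ′ ≡ length Γ × X ∈V Γ′ × Y ∈V Γ′

  -- Γ covers neither X nor Y: the edge guarding D is incident to V₂ and is
  -- exchanged for XY.
  neither : ∀ Γ → EdgeGuardSet o I Γ → ¬ (X ∈V Γ) → ¬ (Y ∈V Γ) → Normalised Γ
  neither Γ eg X∉Γ Y∉Γ with find (All.lookup (proj₂ eg) D∈)
  ... | e , e∈Γ , e-guards-D with guards-incident e-guards-D
  ... | v , e∋v , v∈D with D⊆ v v∈D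
  ... | ι₁ refl      = ⊥-elim (X∉Γ (incident-∈V e∈Γ e∋v))
  ... | ι₂ (ι₁ refl) = ⊥-elim (Y∉Γ (incident-∈V e∈Γ e∋v))
  ... | ι₂ (ι₂ refl) with extract e∈Γ
  ... | L , Γ↭ =
    let Γ′ , eg′ , same-size , X∈Γ′ , Y∈Γ′ , _ = exchange Γ↭ eg X≢Y XY-face Y∉Γ covers
    in  Γ′ , eg′ , same-size , X∈Γ′ , Y∈Γ′
    where
    e-edge = member-edge eg e∈Γ
    covers : ∀ {t} → t ∈ faces o I → Guards e t → X ∈T t ⊎ Y ∈T t ⊎ Any (λ d → Guards d t) L
    covers t∈ = map₂ ι₁ ∘ via-XY e-edge (ι₂ e∋v) (V₂≁Z e-edge e∋v) t∈

  -- Γ covers X but not Y, and the edge e ∈ Γ is incident to V₁ or V₂: if e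
  -- contains Z it is exchanged for ZY (e avoids X, so X stays covered),
  -- otherwise for XY.
  replace-near : ∀ Γ → EdgeGuardSet o I Γ → X ∈V Γ → ¬ (Y ∈V Γ) →
                 ∀ {e} → e ∈ Γ → Incident e V₁ ⊎ Incident e V₂ → Normalised Γ
  replace-near Γ eg X∈Γ Y∉Γ {e} e∈Γ e∋V with extract e∈Γ | (Z ≟ proj₁ e) ⊎-dec (Z ≟ proj₂ e)
  ... | L , Γ↭ | yes e∋Z =
    let Γ′ , eg′ , same-size , _ , Y∈Γ′ , L⊆Γ′ = exchange Γ↭ eg (Y≢Z ∘ sym) ZY-face Y∉Γ covers
    in  Γ′ , eg′ , same-size , L⊆Γ′ X∈L , Y∈Γ′
    where
    e∌X : ¬ Incident e X
    e∌X e∋X = [ (λ e∋V₁ → pigeonhole e∋X e∋Z e∋V₁ (X≢Z , Z≢V₁ , X≢V₁))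
              , (λ e∋V₂ → pigeonhole e∋X e∋Z e∋V₂ (X≢Z , Z≢V₂ , X≢V₂)) ]′ e∋V
    X∈L : X ∈V L
    X∈L with Perm.Any-resp-↭ Γ↭ X∈Γ
    ... | here e∋X  = ⊥-elim (e∌X e∋X)
    ... | there X∈L = X∈L
    covers : ∀ {t} → t ∈ faces o I → Guards e t → Z ∈T t ⊎ Y ∈T t ⊎ Any (λ d → Guards d t) L
    covers t∈ e-guards with guards-incident e-guards
    ... | v , e∋v , v∈t with towards-XY t∈ v∈t (neighbour (member-edge eg e∈Γ) e∋V e∋v)
    ...   | ι₁ X∈t       = ι₂ (ι₂ (Any.map (λ d∋X → incident-guards d∋X X∈t) X∈L))
    ...   | ι₂ (ι₁ Y∈t)  = ι₂ (ι₁ Y∈t)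
    ...   | ι₂ (ι₂ refl) = ι₁ v∈t
  ... | L , Γ↭ | no e∌Z =
    let Γ′ , eg′ , same-size , X∈Γ′ , Y∈Γ′ , _ = exchange Γ↭ eg X≢Y XY-face Y∉Γ covers
    in  Γ′ , eg′ , same-size , X∈Γ′ , Y∈Γ′
    where
    covers : ∀ {t} → t ∈ faces o I → Guards e t → X ∈T t ⊎ Y ∈T t ⊎ Any (λ d → Guards d t) L
    covers t∈ = map₂ ι₁ ∘ via-XY (member-edge eg e∈Γ) e∋V e∌Z t∈

  -- Γ covers X but not Y: the edge guarding E is incident to V₁ or V₂.
  only-X : ∀ Γ → EdgeGuardSet o I Γ → X ∈V Γ → ¬ (Y ∈V Γ) → Normalised Γ
  only-X Γ eg X∈Γ Y∉Γ with find (All.lookup (proj₂ eg) E∈)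
  ... | e , e∈Γ , e-guards-E with guards-incident e-guards-E
  ... | v , e∋v , v∈E with E⊆ v v∈E
  ... | ι₁ refl      = ⊥-elim (Y∉Γ (incident-∈V e∈Γ e∋v))
  ... | ι₂ (ι₁ refl) = replace-near Γ eg X∈Γ Y∉Γ e∈Γ (ι₁ e∋v)
  ... | ι₂ (ι₂ refl) = replace-near Γ eg X∈Γ Y∉Γ e∈Γ (ι₂ e∋v)

module Gadget {n : ℕ} (x y z : Fin n) (g : Tri n) (R : List (Tri n)) where

  X Y Z V₁ V₂ : Fin (suc (suc n))
  X  = inj₂ x
  Y  = inj₂ y
  Z  = inj₂ z
  V₁ = new₁
  V₂ = new₂

  xyV₁ yzV₁ zxV₁ : Tri (suc n)
  xyV₁ = inject₁ x , inject₁ y , fromℕ n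
  yzV₁ = inject₁ y , inject₁ z , fromℕ n
  zxV₁ = inject₁ z , inject₁ x , fromℕ n

  upper lower newFaces : List (Tri (suc (suc n)))
  upper    = (Y , Z , V₁) ∷ (Z , X , V₁) ∷ []
  lower    = (X , Y , V₂) ∷ (Y , V₁ , V₂) ∷ (V₁ , X , V₂) ∷ []
  newFaces = upper ++ lower

  outer : Tri (suc (suc n))
  outer = injT (injT g)

  inner : List (Tri (suc (suc n)))
  inner = map injT (map injT R ++ yzV₁ ∷ zxV₁ ∷ []) ++ lower

  stacked : Stacked n g ((x , y , z) ∷ R) → Stacked (suc (suc n)) outer inner
  stacked H = stack {x = inject₁ x} {y = inject₁ y} {z = fromℕ n} (stack H ↭-refl)
                    (Perm.shift xyV₁ (map injT R) (yzV₁ ∷ zxV₁ ∷ []))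

  faces-split : faces outer inner ≡ map (mapT inj₂) (g ∷ R) ++ newFaces
  faces-split = cong (outer ∷_) (begin
      map injT (map injT R ++ yzV₁ ∷ zxV₁ ∷ []) ++ lower
    ≡⟨ cong (_++ lower) (map-++ injT (map injT R) (yzV₁ ∷ zxV₁ ∷ [])) ⟩
      (map injT (map injT R) ++ upper) ++ lower
    ≡⟨ cong (λ old → (old ++ upper) ++ lower) (sym (map-∘ R)) ⟩
      (map (mapT inj₂) R ++ upper) ++ lower
    ≡⟨ ++-assoc (map (mapT inj₂) R) upper lower ⟩
      map (mapT inj₂) R ++ newFaces
    ∎)
    where open ≡-Reasoning

  new-face : ∀ {P : Tri (suc (suc n)) → Set} → Any P newFaces → Any P (faces outer inner)
  new-face {P} = subst (Any P) (sym faces-split) ∘ AnyP.++⁺ʳ (map (mapT inj₂) (g ∷ R))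

  Five Four : Fin (suc (suc n)) → Set
  Five a = a ≡ X ⊎ a ≡ Y ⊎ a ≡ Z ⊎ a ≡ V₁ ⊎ a ≡ V₂
  Four a = a ≡ X ⊎ a ≡ Y ⊎ a ≡ V₁ ⊎ a ≡ V₂

  X₅ : Five X
  X₅ = ι₁ refl
  Y₅ : Five Y
  Y₅ = ι₂ (ι₁ refl)
  Z₅ : Five Z
  Z₅ = ι₂ (ι₂ (ι₁ refl))
  V₁₅ : Five V₁
  V₁₅ = ι₂ (ι₂ (ι₂ (ι₁ refl)))
  V₂₅ : Five V₂
  V₂₅ = ι₂ (ι₂ (ι₂ (ι₂ refl)))

  X₄ : Four X
  X₄ = ι₁ refl
  Y₄ : Four Y
  Y₄ = ι₂ (ι₁ refl)
  V₁₄ : Four V₁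
  V₁₄ = ι₂ (ι₂ (ι₁ refl))
  V₂₄ : Four V₂
  V₂₄ = ι₂ (ι₂ (ι₂ refl))

  newFaces-local : All (λ t → ∀ v → v ∈T t → Five v) newFaces
  newFaces-local = corners Y₅ Z₅ V₁₅ ∷ corners Z₅ X₅ V₁₅ ∷
                   corners X₅ Y₅ V₂₅ ∷ corners Y₅ V₁₅ V₂₅ ∷ corners V₁₅ X₅ V₂₅ ∷ []

  V₁≢old : ∀ {a : Fin n} → V₁ ≢ inj₂ a
  V₁≢old = fromℕ≢inject₁ ∘ inject₁-injective

  V₂≢old : ∀ {a : Fin n} → V₂ ≢ inj₂ a
  V₂≢old = fromℕ≢inject₁

  V₂≢V₁ : V₂ ≢ V₁
  V₂≢V₁ = fromℕ≢inject₁

  Local : Tri (suc (suc n)) → Set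
  Local t = (V₁ ∈T t → (X ∈T t ⊎ Y ∈T t) × (∀ a → a ∈T t → Five a)) ×
            (V₂ ∈T t → (X ∈T t ⊎ Y ∈T t) × (∀ a → a ∈T t → Four a))

  -- Old faces avoid V₁ and V₂; each new face contains X or Y.
  all-local : All Local (faces outer inner)
  all-local = subst (All Local) (sym faces-split)
    (AllP.++⁺ (AllP.map⁺ (All.universal old (g ∷ R)))
      ( ((λ _ → ι₂ (corner₁ refl) , corners Y₅ Z₅ V₁₅) ,
         ⊥-elim ∘ not-corner V₂≢old V₂≢old V₂≢V₁)
      ∷ ((λ _ → ι₁ (corner₂ refl) , corners Z₅ X₅ V₁₅) ,
         ⊥-elim ∘ not-corner V₂≢old V₂≢old V₂≢V₁)
      ∷ (⊥-elim ∘ not-corner V₁≢old V₁≢old (V₂≢V₁ ∘ sym) ,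
         (λ _ → ι₁ (corner₁ refl) , corners X₄ Y₄ V₂₄))
      ∷ ((λ _ → ι₂ (corner₁ refl) , corners Y₅ V₁₅ V₂₅) ,
         (λ _ → ι₂ (corner₁ refl) , corners Y₄ V₁₄ V₂₄))
      ∷ ((λ _ → ι₁ (corner₂ refl) , corners V₁₅ X₅ V₂₅) ,
         (λ _ → ι₁ (corner₂ refl) , corners V₁₄ X₄ V₂₄))
      ∷ []))
    where
    old : ∀ u → Local (mapT inj₂ u)
    old u = ⊥-elim ∘ not-corner V₁≢old V₁≢old V₁≢old ,
            ⊥-elim ∘ not-corner V₂≢old V₂≢old V₂≢old

  module _ (xyz-distinct : Distinct (x , y , z)) where

    inj₂-injective : ∀ {a b : Fin n} → inj₂ a ≡ inj₂ b → a ≡ b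
    inj₂-injective = inject₁-injective ∘ inject₁-injective

    X≢Y : X ≢ Y
    X≢Y = proj₁ xyz-distinct ∘ inj₂-injective
    Y≢Z : Y ≢ Z
    Y≢Z = proj₁ (proj₂ xyz-distinct) ∘ inj₂-injective
    X≢Z : X ≢ Z
    X≢Z = proj₂ (proj₂ xyz-distinct) ∘ inj₂-injective

    swap₁₂ : ∀ {A B C : Set} → A ⊎ B ⊎ C → B ⊎ A ⊎ C
    swap₁₂ (ι₁ a)      = ι₂ (ι₁ a)
    swap₁₂ (ι₂ (ι₁ b)) = ι₁ b
    swap₁₂ (ι₂ (ι₂ c)) = ι₂ (ι₂ c)

    mirror : ∀ {t : Tri (suc (suc n))} {A B C : Set} {P : Fin (suc (suc n)) → Set} →
             (C → (A ⊎ B) × (∀ a → a ∈T t → P a)) → {Q : Fin (suc (suc n)) → Set} →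
             (∀ {a} → P a → Q a) → C → (B ⊎ A) × (∀ a → a ∈T t → Q a)
    mirror local P⇒Q c = swap (proj₁ (local c)) , λ a a∈t → P⇒Q (proj₂ (local c) a a∈t)

    -- LocalExchange applied to X, Y and to the mirror configuration Y, X
    -- (in which the face (V₁,X,V₂) and the edge XZ take the roles of
    -- (Y,V₁,V₂) and ZY).
    module Direct = LocalExchange outer inner X Y Z V₁ V₂
      X≢Y X≢Z Y≢Z (V₁≢old ∘ sym) (V₂≢old ∘ sym) (V₁≢old ∘ sym) (V₂≢old ∘ sym)
      (All.map proj₁ all-local) (All.map proj₂ all-local)
      (X , Y , V₂) (new-face (there (there (here refl)))) (λ v v∈ → v∈)
      (Y , V₁ , V₂) (new-face (there (there (there (here refl))))) (λ v v∈ → v∈)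
      (new-face (there (there (here (corner₁ refl , corner₂ refl)))))
      (new-face (here (corner₂ refl , corner₁ refl)))

    module Mirror = LocalExchange outer inner Y X Z V₁ V₂
      (X≢Y ∘ sym) Y≢Z X≢Z (V₁≢old ∘ sym) (V₂≢old ∘ sym) (V₁≢old ∘ sym) (V₂≢old ∘ sym)
      (All.map (λ l → mirror (proj₁ l) swap₁₂) all-local)
      (All.map (λ l → mirror (proj₂ l) swap₁₂) all-local)
      (X , Y , V₂) (new-face (there (there (here refl)))) (λ v → swap₁₂)
      (V₁ , X , V₂) (new-face (there (there (there (there (here refl)))))) (λ v → swap₁₂)
      (new-face (there (there (here (corner₂ refl , corner₁ refl)))))
      (new-face (there (here (corner₁ refl , corner₂ refl))))

    normalise : ∀ Γ → EdgeGuardSet outer inner Γ →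
                Σ (List (Fin (suc (suc n)) × Fin (suc (suc n)))) λ Γ′ →
                  EdgeGuardSet outer inner Γ′ × length Γ′ ≡ length Γ × X ∈V Γ′ × Y ∈V Γ′
    normalise Γ eg with covered? X Γ | covered? Y Γ
    ... | yes X∈Γ | yes Y∈Γ = Γ , eg , refl , X∈Γ , Y∈Γ
    ... | yes X∈Γ | no Y∉Γ  = Direct.only-X Γ eg X∈Γ Y∉Γ
    ... | no X∉Γ  | no Y∉Γ  = Direct.neither Γ eg X∉Γ Y∉Γ
    ... | no X∉Γ  | yes Y∈Γ =
      let Γ′ , eg′ , same-size , Y∈Γ′ , X∈Γ′ = Mirror.only-X Γ eg Y∈Γ X∉Γ
      in  Γ′ , eg′ , same-size , X∈Γ′ , Y∈Γ′

≅T-refl : ∀ {n} {t : Tri n} → t ≅T t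
≅T-refl v = (λ v∈t → v∈t) , (λ v∈t → v∈t)

-- G is the gadget built in the re-rooted H; T lists its five new faces.
lemma4 : ∀ {n} {o : Tri n} {I : List (Tri n)} → Stacked n o I →
         ∀ (f : Tri n) (R : List (Tri n)) → faces o I ↭ (f ∷ R) →
         ∀ (x y z : Fin n) → f ≅T (x , y , z) →
         Σ (Tri (suc (suc n))) λ o′ → Σ (List (Tri (suc (suc n)))) λ I′ →
           Stacked (suc (suc n)) o′ I′ ×
           (Σ (List (Tri (suc (suc n)))) λ T →
              faces o′ I′ ↭ (map (mapT inj₂) R ++ T) ×
              All (λ t → ∀ v → v ∈T t →
                     v ≡ inj₂ x ⊎ v ≡ inj₂ y ⊎ v ≡ inj₂ z ⊎ v ≡ new₁ ⊎ v ≡ new₂) T) ×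
           (∀ (Γ : List (Fin (suc (suc n)) × Fin (suc (suc n)))) → EdgeGuardSet o′ I′ Γ →
              Σ (List (Fin (suc (suc n)) × Fin (suc (suc n)))) λ Γ′ →
                EdgeGuardSet o′ I′ Γ′ × length Γ′ ≡ length Γ ×
                inj₂ x ∈V Γ′ × inj₂ y ∈V Γ′)
lemma4 S f R f-face x y z f≅xyz with reroot S f-face
... | g , R₁ , H , g∷R₁↭R with stacked-distinct H
... | _ ∷ f-distinct ∷ _ =
  outer , inner , stacked H′ , (newFaces , faces-perm , newFaces-local) ,
  normalise (distinct-≅ f≅xyz f-distinct)
  where
  open Gadget x y z g R₁
  H′ : Stacked _ g ((x , y , z) ∷ R₁)
  H′ = reorder H ≅T-refl (f≅xyz ∷ Pointwise.refl ≅T-refl)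
  faces-perm : faces outer inner ↭ map (mapT inj₂) R ++ newFaces
  faces-perm = ↭-trans (↭-reflexive faces-split)
                       (Perm.++⁺ʳ newFaces (Perm.map⁺ (mapT inj₂) g∷R₁↭R))
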